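{- Let $\mathbb{S}=(S,\mathrm{CON},\Vdash)$ be a simplified continuous information system. Define $\mathcal{F}(\mathbb{S})=(A,(\widehat{\mathrm{Con}}_X)_{X\in A},(\Vdash^{\mathcal F}_X)_{X\in A})$ by $A=\mathrm{CON}$, $\widehat{\mathrm{Con}}_X=\{\mathfrak{X}\subseteq A \text{ finite} : \mathfrak{X}=\{X\} \text{ or } (\forall Y\in\mathfrak{X})\, X\Vdash Y\}$ for $X\in\mathrm{CON}$, and, for $X\in\mathrm{CON}$, $\mathfrak{X}\in\widehat{\mathrm{Con}}_X$ and $Y\in\mathrm{CON}$: $\mathfrak{X}\Vdash^{\mathcal F}_X Y$ iff there is $E\in\mathfrak{X}\cup\{X\}$ with $E\Vdash Y$. Then $\mathcal{F}(\mathbb{S})$ is a strong continuous information frame.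
   Context: A simplified continuous information system is a triple $(S,\mathrm{CON},\Vdash)$ with $S$ a set, $\mathrm{CON}$ a collection of finite subsets of $S$ and $\Vdash\subseteq\mathrm{CON}\times S$, such that for all $X,Y\in\mathrm{CON}$, $a\in S$ and finite $F\subseteq S$ (writing $X\Vdash Y$ iff $X\Vdash b$ for all $b\in Y$): (1) $\{a\}\in\mathrm{CON}$; (2) if $X\subseteq Y$ and $X\Vdash a$ then $Y\Vdash a$; (3) if $X\Vdash Y$ and $Y\Vdash a$ then $X\Vdash a$; (4) if $X\Vdash a$ then there is $Z\in\mathrm{CON}$ with $X\Vdash Z$ and $Z\Vdash a$; (5) if $X\Vdash F$ then there is $Z\in\mathrm{CON}$ with $F\subseteq Z$ and $X\Vdash Z$. A continuous information frame is a triple $\mathbb{A}=(A,(\mathrm{Con}_i)_{i\in A},(\vDash_i)_{i\in A})$ where $A$ is a set, each $\mathrm{Con}_i$ is a set of finite subsets of $A$, and $\vDash_i\subseteq\mathrm{Con}_i\times A$; write $iRj$ iff $\{i\}\in\mathrm{Con}_j$, and for finite $Y$, $X\vDash_i Y$ iff $X\vDash_i b$ for all $b\in Y$. Required, for all $i,j,a\in A$ and finite $X,Y\subseteq A$: (i) $\{i\}\in\mathrm{Con}_i$; (ii) if $Y\subseteq X\in\mathrm{Con}_i$ then $Y\in\mathrm{Con}_i$; (iii) if $X\in\mathrm{Con}_i$ and $X\vDash_i Y$ then $Y\in\mathrm{Con}_i$; (iv) if $X,Y\in\mathrm{Con}_i$, $X\subseteq Y$ and $X\vDash_i a$ then $Y\vDash_i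 a$; (v) if $X\in\mathrm{Con}_i$, $X\vDash_i Y$ and $Y\vDash_i a$ then $X\vDash_i a$; (vi) if $iRj$ then $\mathrm{Con}_i\subseteq\mathrm{Con}_j$; (vii) if $iRj$, $X\in\mathrm{Con}_i$ and $X\vDash_i a$ then $X\vDash_j a$; (viii) if $X\vDash_i Y$ then there exist $e\in A$ and $Z\in\mathrm{Con}_e$ with $X\vDash_i \{e\}\cup Z$ and $Z\vDash_e Y$. The frame is strong if for all $i\in A$ and $X\in\mathrm{Con}_i$ with $X\neq\{i\}$ we have $\{i\}\vDash_i X$. -}

module Defs where

open import Level using (Level; _⊔_) renaming (suc to lsuc)
open import Data.List using (List; []; _∷_)
open import Data.List.Membership.Propositional using (_∈_)
open import Data.List.Relation.Binary.Subset.Propositional using (_⊆_)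
open import Data.Product using (Σ; _×_; proj₁)
open import Data.Sum using (_⊎_)
open import Relation.Nullary using (¬_)

-- Finite subsets are represented by lists; equality of finite subsets is
-- extensional (same elements).
_≐_ : ∀ {a} {A : Set a} → List A → List A → Set a
X ≐ Y = X ⊆ Y × Y ⊆ X

Ents : ∀ {a b ℓ} {A : Set a} {B : Set b} → (A → B → Set ℓ) → A → List B → Set (b ⊔ ℓ)
Ents R X Y = ∀ {y} → y ∈ Y → R X y

record IsSCIS {a ℓ} {S : Set a} (CON : List S → Set ℓ) (_⊩_ : List S → S → Set ℓ)
       : Set (a ⊔ ℓ) where
  field
    ⊩-dom    : ∀ {X s} → X ⊩ s → CON X
    con-single : ∀ s → CON (s ∷ [])
    ⊩-mono   : ∀ {X Y s} → CON X → CON Y → X ⊆ Y → X ⊩ s → Y ⊩ s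
    ⊩-trans  : ∀ {X Y s} → CON X → CON Y → Ents _⊩_ X Y → Y ⊩ s → X ⊩ s
    ⊩-interp : ∀ {X s} → CON X → X ⊩ s →
               Σ (List S) λ Z → CON Z × Ents _⊩_ X Z × Z ⊩ s
    ⊩-collect : ∀ {X} (F : List S) → CON X → Ents _⊩_ X F →
               Σ (List S) λ Z → CON Z × F ⊆ Z × Ents _⊩_ X Z

-- Continuous information frame (A, (Con_i), (⊨_i))
-- Con i X  :  X ∈ Con_i ;   Ent i X b  :  X ⊨_i b

module _ {a ℓ} {A : Set a} (Con : A → List A → Set ℓ) (Ent : A → List A → A → Set ℓ) where

  R : A → A → Set ℓ
  R i j = Con j (i ∷ [])

  record IsCIF : Set (a ⊔ ℓ) where
    field
      ent-dom  : ∀ {i X b} → Ent i X b → Con i X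
      con-refl : ∀ i → Con i (i ∷ [])
      con-down : ∀ {i X Y} → Y ⊆ X → Con i X → Con i Y
      con-ent  : ∀ {i X Y} → Con i X → Ents (Ent i) X Y → Con i Y
      ent-mono : ∀ {i X Y b} → Con i X → Con i Y → X ⊆ Y → Ent i X b → Ent i Y b
      ent-trans : ∀ {i X Y b} → Con i X → Ents (Ent i) X Y → Ent i Y b → Ent i X b
      R-con    : ∀ {i j X} → R i j → Con i X → Con j X
      R-ent    : ∀ {i j X b} → R i j → Con i X → Ent i X b → Ent j X b
      ent-interp : ∀ {i X Y} → Con i X → Ents (Ent i) X Y →
                   Σ A λ e → Σ (List A) λ Z →
                     Con e Z × Ents (Ent i) X (e ∷ Z) × Ents (Ent e) Z Y

  record IsStrongCIF : Set (a ⊔ ℓ) where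
    field
      isCIF  : IsCIF
      strong : ∀ {i X} → Con i X → ¬ (X ≐ (i ∷ [])) → Ents (Ent i) (i ∷ []) X

module _ {a ℓ} {S : Set a} (CON : List S → Set ℓ) (_⊩_ : List S → S → Set ℓ) where

  FA : Set (a ⊔ ℓ)
  FA = Σ (List S) CON

  FCon : FA → List FA → Set (a ⊔ ℓ)
  FCon X 𝔛 = (𝔛 ≐ (X ∷ [])) ⊎ (∀ {Y} → Y ∈ 𝔛 → Ents _⊩_ (proj₁ X) (proj₁ Y))

  FEnt : FA → List FA → FA → Set (a ⊔ ℓ)
  FEnt X 𝔛 Y = FCon X 𝔛 × Σ FA λ E → E ∈ (X ∷ 𝔛) × Ents _⊩_ (proj₁ E) (proj₁ Y)

{-# OPTIONS --safe #-}
-- Every member of 𝔛 ∈ Con^_X is X itself or entailed by X, so 𝔛 ⊩^F_X Y holds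
-- exactly when 𝔛 ∈ Con^_X and X ⊩ Y.  With this description all frame axioms
-- except (viii) reduce to transitivity of ⊩ on finite sets, and the frame is
-- strong by construction.  For (viii), X ⊩ Y for all Y ∈ 𝔜 means X ⊩ ⋃𝔜; an
-- interpolant Z of X ⊩ ⋃𝔜 in S, obtained elementwise from (4) and assembled
-- with (5), is the required point e.
module Submission where

open import Level using (_⊔_)
open import Defs
open import Data.List using (List; []; _∷_; _++_; concatMap)
open import Data.List.Membership.Propositional using (_∈_; find; lose)
open import Data.List.Membership.Propositional.Properties
  using (∈-++⁺ˡ; ∈-++⁺ʳ; ∈-++⁻; ∈-concatMap⁺; ∈-concatMap⁻)
open import Data.List.Relation.Binary.Subset.Propositional using (_⊆_)
open import Data.List.Relation.Unary.Any using (here; there)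
open import Data.List.Relation.Unary.Any.Properties using (singleton⁻)
open import Data.Product using (Σ; _×_; _,_; proj₁; proj₂)
open import Data.Sum using (_⊎_; inj₁; inj₂; [_,_]′)
open import Relation.Binary.PropositionalEquality using (_≡_; refl; sym)
open import Relation.Nullary using (¬_; contradiction)

≐-refl : ∀ {a} {A : Set a} {X : List A} → X ≐ X
≐-refl = (λ q → q) , (λ q → q)

module _ {a ℓ} {S : Set a} {CON : List S → Set ℓ} {_⊩_ : List S → S → Set ℓ}
         (sc : IsSCIS CON _⊩_) where
  open IsSCIS sc

  _⊩*_ : List S → List S → Set (a ⊔ ℓ)
  _⊩*_ = Ents _⊩_

  ⊩*-trans : ∀ {X Y W} → CON X → CON Y → X ⊩* Y → Y ⊩* W → X ⊩* W
  ⊩*-trans cX cY XY YW q = ⊩-trans cX cY XY (YW q)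

  ⊩*-join : ∀ {X Z₁ Z₂} → CON X → X ⊩* Z₁ → X ⊩* Z₂ →
            Σ (List S) λ Z → CON Z × Z₁ ⊆ Z × Z₂ ⊆ Z × X ⊩* Z
  ⊩*-join {Z₁ = Z₁} {Z₂} cX XZ₁ XZ₂ =
    let Z , cZ , Z₁++Z₂⊆Z , XZ = ⊩-collect (Z₁ ++ Z₂) cX (λ q → [ XZ₁ , XZ₂ ]′ (∈-++⁻ Z₁ q))
    in Z , cZ , (λ q → Z₁++Z₂⊆Z (∈-++⁺ˡ q)) , (λ q → Z₁++Z₂⊆Z (∈-++⁺ʳ Z₁ q)) , XZ

  ⊩*-interp : ∀ {X} U → CON X → X ⊩* U →
              Σ (List S) λ Z → CON Z × X ⊩* Z × Z ⊩* U
  ⊩*-interp [] cX _ =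
    let Z , cZ , _ , XZ = ⊩-collect [] cX (λ ())
    in Z , cZ , XZ , λ ()
  ⊩*-interp (u ∷ U) cX XuU =
    let Z₁ , cZ₁ , XZ₁ , Z₁u = ⊩-interp cX (XuU (here refl))
        Z₂ , cZ₂ , XZ₂ , Z₂U = ⊩*-interp U cX (λ q → XuU (there q))
        Z , cZ , Z₁⊆Z , Z₂⊆Z , XZ = ⊩*-join cX XZ₁ XZ₂
    in Z , cZ , XZ , λ { (here refl) → ⊩-mono cZ₁ cZ Z₁⊆Z Z₁u
                       ; (there q)   → ⊩-mono cZ₂ cZ Z₂⊆Z (Z₂U q) }

  ⊩*-interp-all : ∀ {b} {B : Set b} (f : B → List S) {X} (𝔜 : List B) → CON X →
                  (∀ {Y} → Y ∈ 𝔜 → X ⊩* f Y) →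
                  Σ (List S) λ Z → CON Z × X ⊩* Z × (∀ {Y} → Y ∈ 𝔜 → Z ⊩* f Y)
  ⊩*-interp-all f 𝔜 cX X𝔜 =
    let Z , cZ , XZ , Z⋃𝔜 = ⊩*-interp (concatMap f 𝔜) cX λ q →
          let _ , Y∈𝔜 , y∈Y = find (∈-concatMap⁻ f q) in X𝔜 Y∈𝔜 y∈Y
    in Z , cZ , XZ , λ Y∈𝔜 y∈Y → Z⋃𝔜 (∈-concatMap⁺ f (lose Y∈𝔜 y∈Y))

  private
    A : Set (a ⊔ ℓ)
    A = FA CON _⊩_

    Con : A → List A → Set (a ⊔ ℓ)
    Con = FCon CON _⊩_

    Ent : A → List A → A → Set (a ⊔ ℓ)
    Ent = FEnt CON _⊩_

  _⊩ᶠ_ : A → A → Set (a ⊔ ℓ)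
  X ⊩ᶠ Y = proj₁ X ⊩* proj₁ Y

  FCon-member : ∀ {X 𝔛 E} → Con X 𝔛 → E ∈ 𝔛 → E ≡ X ⊎ X ⊩ᶠ E
  FCon-member (inj₁ (𝔛⊆[X] , _)) q = inj₁ (singleton⁻ (𝔛⊆[X] q))
  FCon-member (inj₂ X𝔛)          q = inj₂ (X𝔛 q)

  FCon-[] : ∀ {X} → Con X []
  FCon-[] = inj₂ λ ()

  FCon-down : ∀ {X 𝔛 𝔜} → 𝔜 ⊆ 𝔛 → Con X 𝔛 → Con X 𝔜
  FCon-down {𝔜 = []}    _   _                    = FCon-[]
  FCon-down {𝔜 = Y ∷ _} 𝔜⊆𝔛 (inj₁ (𝔛⊆[X] , _)) =
    inj₁ ( (λ q → 𝔛⊆[X] (𝔜⊆𝔛 q))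
         , λ { (here refl) → here (sym (singleton⁻ (𝔛⊆[X] (𝔜⊆𝔛 (here refl))))) ; (there ()) })
  FCon-down 𝔜⊆𝔛 (inj₂ X𝔛) = inj₂ λ q → X𝔛 (𝔜⊆𝔛 q)

  FCon-⊩ᶠ : ∀ {X W 𝔛} → W ⊩ᶠ X → Con X 𝔛 → Con W 𝔛
  FCon-⊩ᶠ {X} {W} WX c = inj₂ λ q →
    [ (λ { refl → WX }) , ⊩*-trans (proj₂ W) (proj₂ X) WX ]′ (FCon-member c q)

  -- The target is a list rather than a point of A: a point would occur here
  -- only under proj₁ and could not be inferred.
  FEnt⇒⊩* : ∀ {X 𝔛 V} → Con X 𝔛 × (Σ A λ E → E ∈ X ∷ 𝔛 × proj₁ E ⊩* V) → proj₁ X ⊩* V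
  FEnt⇒⊩* (_ , _ , here refl , XV) = XV
  FEnt⇒⊩* {X} (c , E , there q , EV) with FCon-member c q
  ... | inj₁ refl = EV
  ... | inj₂ XE   = ⊩*-trans (proj₂ X) (proj₂ E) XE EV

  R⇒≡⊎⊩ᶠ : ∀ {i j} → R Con Ent i j → i ≡ j ⊎ j ⊩ᶠ i
  R⇒≡⊎⊩ᶠ r = FCon-member r (here refl)

  R-⊩* : ∀ {i j V} → R Con Ent i j → proj₁ i ⊩* V → proj₁ j ⊩* V
  R-⊩* {i} {j} r iV with R⇒≡⊎⊩ᶠ r
  ... | inj₁ refl = iV
  ... | inj₂ ji   = ⊩*-trans (proj₂ j) (proj₂ i) ji iV

  R-FCon : ∀ {i j 𝔛} → R Con Ent i j → Con i 𝔛 → Con j 𝔛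
  R-FCon r c with R⇒≡⊎⊩ᶠ r
  ... | inj₁ refl = c
  ... | inj₂ ji   = FCon-⊩ᶠ ji c

  -- The interpolating set can be taken empty: ∅ ⊩^F_e Y just says e ⊩ Y.
  FEnt-interp : ∀ {i 𝔛 𝔜} → Con i 𝔛 → Ents (Ent i) 𝔛 𝔜 →
                Σ A λ e → Σ (List A) λ 𝔷 →
                  Con e 𝔷 × Ents (Ent i) 𝔛 (e ∷ 𝔷) × Ents (Ent e) 𝔷 𝔜
  FEnt-interp {i} {𝔜 = 𝔜} c 𝔛𝔜 =
    let Z , cZ , iZ , Z𝔜 = ⊩*-interp-all proj₁ 𝔜 (proj₂ i) (λ q → FEnt⇒⊩* (𝔛𝔜 q))
    in (Z , cZ) , [] , FCon-[] ,
       (λ { (here refl) → c , i , here refl , iZ ; (there ()) }) ,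
       (λ q → FCon-[] , (Z , cZ) , here refl , Z𝔜 q)

  F-isCIF : IsCIF Con Ent
  F-isCIF = record
    { ent-dom    = proj₁
    ; con-refl   = λ _ → inj₁ ≐-refl
    ; con-down   = FCon-down
    ; con-ent    = λ _ 𝔛𝔜 → inj₂ λ q → FEnt⇒⊩* (𝔛𝔜 q)
    ; ent-mono   = λ _ c _ e → c , _ , here refl , FEnt⇒⊩* e
    ; ent-trans  = λ c _ e → c , _ , here refl , FEnt⇒⊩* e
    ; R-con      = R-FCon
    ; R-ent      = λ r c e → R-FCon r c , _ , here refl , R-⊩* r (FEnt⇒⊩* e)
    ; ent-interp = FEnt-interp
    }

  F-strong : ∀ {i 𝔛} → Con i 𝔛 → ¬ (𝔛 ≐ (i ∷ [])) → Ents (Ent i) (i ∷ []) 𝔛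
  F-strong (inj₁ 𝔛≐[i]) 𝔛≢[i] = contradiction 𝔛≐[i] 𝔛≢[i]
  F-strong (inj₂ i𝔛)    _     q = inj₁ ≐-refl , _ , here refl , i𝔛 q

theorem4p1 : ∀ {a ℓ} {S : Set a} (CON : List S → Set ℓ) (_⊩_ : List S → S → Set ℓ) →
    IsSCIS CON _⊩_ → IsStrongCIF (FCon CON _⊩_) (FEnt CON _⊩_)
theorem4p1 CON _⊩_ sc = record { isCIF = F-isCIF sc ; strong = F-strong sc }
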